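{- Let $b\ge 2$ and let $n$ be an integer with $1\le n\le b-1$. Then the $(j,k)$-entry $\chi_n(j,k)$ ($0\le j,k\le b-1$) of the matrix power $X_{b,1}(x)^n$ is \[ \chi_n(j,k)=\begin{cases} \dfrac{n!}{(j-k)!}\,c(j-k,n)\,x^n, & \text{if } j\ge k+n,\\ 0, & \text{otherwise}. \end{cases} \]
   Context: Rows and columns are indexed from $0$. $X_{b,1}(x)$ is the $b\times b$ strictly lower-triangular matrix whose $(j,k)$-entry is $x/(j-k)$ if $j\ge k+1$ and $0$ otherwise. The unsigned Stirling numbers of the first kind $c(m,k)$ are defined by $x(x+1)\cdots(x+m-1)=\sum_{k=0}^m c(m,k)x^k$. -}

module Defs where

open import Data.Nat as ℕ using (ℕ; zero; suc; _∸_; _!)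
open import Data.Nat.Properties using (_!≢0)
open import Data.Fin using (Fin; zero; suc; toℕ)
open import Data.Integer using (+_)
open import Data.Rational using (ℚ; _/_; _+_; _*_; 0ℚ; 1ℚ)
open import Relation.Nullary using (yes; no)
open import Data.Fin using (_≟_)

Mat : ℕ → Set
Mat b = Fin b → Fin b → ℚ

∑ : ∀ {b} → (Fin b → ℚ) → ℚ
∑ {zero}  f = 0ℚ
∑ {suc b} f = f zero + ∑ (λ i → f (suc i))

_⊗_ : ∀ {b} → Mat b → Mat b → Mat b
(A ⊗ B) i k = ∑ (λ l → A i l * B l k)

idMat : ∀ {b} → Mat b
idMat i k with i ≟ k
... | yes _ = 1ℚ
... | no  _ = 0ℚ

matPow : ∀ {b} → Mat b → ℕ → Mat b
matPow A zero    = idMat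
matPow A (suc n) = A ⊗ matPow A n

-- 1/m as a rational for m ≥ 1 (value at 0 irrelevant, never used)
recipℕ : ℕ → ℚ
recipℕ zero    = 0ℚ
recipℕ (suc d) = + 1 / suc d

X : (b : ℕ) → ℚ → Mat b
X b x j k with toℕ k ℕ.<? toℕ j
... | yes _ = x * recipℕ (toℕ j ∸ toℕ k)
... | no  _ = 0ℚ

-- unsigned Stirling numbers of the first kind:
-- x(x+1)...(x+m-1) = Σ_k c(m,k) x^k
stirling1 : ℕ → ℕ → ℕ
stirling1 zero    zero    = 1
stirling1 zero    (suc k) = 0
stirling1 (suc m) zero    = 0
stirling1 (suc m) (suc k) = m ℕ.* stirling1 m (suc k) ℕ.+ stirling1 m k

factRatio : ℕ → ℕ → ℚ
factRatio n m = (+ (n !) / (m !)) {{m !≢0}}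

ℕtoℚ : ℕ → ℚ
ℕtoℚ m = + m / 1

_^ℚ_ : ℚ → ℕ → ℚ
x ^ℚ zero  = 1ℚ
x ^ℚ suc n = x * (x ^ℚ n)

{-# OPTIONS --safe #-}
module Submission where

open import Defs

-- X_{b,1}(x) is the lower-triangular Toeplitz matrix with symbol d ↦ x/d, and 1/d is the
-- coefficient of t^d in -log(1-t). A product of lower-triangular Toeplitz matrices is Toeplitz with
-- the convolution of the symbols, so X^n has symbol x^n · ℓ^{⋆n} with ℓ = (1/d)_d. Since
-- (-log(1-t))^n / n! is the exponential generating function of c(·,n), ℓ^{⋆n}(d) = s_n(d) with
-- s_n(d) = n!/d! · c(d,n). Without power series: multiplying the d-th term by d (differentiating,
-- where -log(1-t) has derivative 1/(1-t)), both ℓ ⋆ s_n and s_{n+1} vanish at 0 and satisfy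
-- (d+1)·u(d+1) = d·u(d) + (n+1)·s_n(d); for s_{n+1} this is the recurrence
-- c(d+1,n+1) = d·c(d,n+1) + c(d,n), for ℓ ⋆ s_n it follows from that recurrence for s_n and
-- induction on n.

-- The development sits in an anonymous module because it opens ℚ's _+_, whereas the statement
-- of lemma2p7 uses ℕ's.
module _ where
  open import Data.Nat as ℕ using (ℕ; zero; suc; pred; _∸_; _!; _<_; _≤_; NonZero; z≤n; s≤s)
  import Data.Nat.Properties as ℕₚ
  import Data.Nat.Tactic.RingSolver as ℕ-Solver
  open import Data.Fin as Fin using (Fin; toℕ)
  open import Data.Fin.Properties using (toℕ<n; toℕ-injective)
  open import Data.Integer as ℤ using (+_)
  import Data.Integer.Properties as ℤₚ
  import Data.Integer.Tactic.RingSolver as ℤ-Solver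
  open import Data.Rational using (ℚ; _/_; _+_; _*_; 0ℚ; 1ℚ; toℚᵘ; fromℚᵘ)
  open import Data.Rational.Properties
  open import Data.Rational.Unnormalised as ℚᵘ using (mkℚᵘ; *≡*)
  import Data.Rational.Unnormalised.Properties as ℚᵘₚ
  open import Data.Rational.Solver using (module +-*-Solver)
  open +-*-Solver
  open import Data.Product using (_,_)
  open import Relation.Nullary using (yes; no; ¬_)
  open import Relation.Nullary.Negation using (contradiction)
  open import Relation.Binary.PropositionalEquality
  open ≡-Reasoning

  fromℚᵘ-homo-+ : ∀ p q → fromℚᵘ (p ℚᵘ.+ q) ≡ fromℚᵘ p + fromℚᵘ q
  fromℚᵘ-homo-+ p q = toℚᵘ-injective (ℚᵘₚ.≃-trans (toℚᵘ-fromℚᵘ (p ℚᵘ.+ q))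
    (ℚᵘₚ.≃-sym (ℚᵘₚ.≃-trans (toℚᵘ-homo-+ (fromℚᵘ p) (fromℚᵘ q))
                            (ℚᵘₚ.+-cong (toℚᵘ-fromℚᵘ p) (toℚᵘ-fromℚᵘ q)))))

  fromℚᵘ-homo-* : ∀ p q → fromℚᵘ (p ℚᵘ.* q) ≡ fromℚᵘ p * fromℚᵘ q
  fromℚᵘ-homo-* p q = toℚᵘ-injective (ℚᵘₚ.≃-trans (toℚᵘ-fromℚᵘ (p ℚᵘ.* q))
    (ℚᵘₚ.≃-sym (ℚᵘₚ.≃-trans (toℚᵘ-homo-* (fromℚᵘ p) (fromℚᵘ q))
                            (ℚᵘₚ.*-cong (toℚᵘ-fromℚᵘ p) (toℚᵘ-fromℚᵘ q)))))

  -- ℕtoℚ m and + p / suc q are definitionally fromℚᵘ (mkℚᵘ (+ m) 0) and fromℚᵘ (mkℚᵘ (+ p) q).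

  ℕtoℚ-homo-+ : ∀ m n → ℕtoℚ (m ℕ.+ n) ≡ ℕtoℚ m + ℕtoℚ n
  ℕtoℚ-homo-+ m n = trans (fromℚᵘ-cong casted) (fromℚᵘ-homo-+ (mkℚᵘ (+ m) 0) (mkℚᵘ (+ n) 0))
    where
    identity : ∀ a b → (a ℤ.+ b) ℤ.* (+ 1 ℤ.* + 1) ≡ (a ℤ.* + 1 ℤ.+ b ℤ.* + 1) ℤ.* + 1
    identity = ℤ-Solver.solve-∀
    casted : mkℚᵘ (+ (m ℕ.+ n)) 0 ℚᵘ.≃ mkℚᵘ (+ m) 0 ℚᵘ.+ mkℚᵘ (+ n) 0
    casted = *≡* (trans (cong (ℤ._* (+ 1 ℤ.* + 1)) (ℤₚ.pos-+ m n)) (identity (+ m) (+ n)))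

  ℕtoℚ-homo-* : ∀ m n → ℕtoℚ (m ℕ.* n) ≡ ℕtoℚ m * ℕtoℚ n
  ℕtoℚ-homo-* m n = trans (fromℚᵘ-cong casted) (fromℚᵘ-homo-* (mkℚᵘ (+ m) 0) (mkℚᵘ (+ n) 0))
    where
    identity : ∀ a b → (a ℤ.* b) ℤ.* (+ 1 ℤ.* + 1) ≡ (a ℤ.* b) ℤ.* + 1
    identity = ℤ-Solver.solve-∀
    casted : mkℚᵘ (+ (m ℕ.* n)) 0 ℚᵘ.≃ mkℚᵘ (+ m) 0 ℚᵘ.* mkℚᵘ (+ n) 0
    casted = *≡* (trans (cong (ℤ._* (+ 1 ℤ.* + 1)) (ℤₚ.pos-* m n)) (identity (+ m) (+ n)))

  ℕtoℚ-*-/ : ∀ p q .{{_ : NonZero q}} → ℕtoℚ q * (+ p / q) ≡ ℕtoℚ p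
  ℕtoℚ-*-/ p (suc q) = trans (sym (fromℚᵘ-homo-* (mkℚᵘ (+ suc q) 0) (mkℚᵘ (+ p) q))) (fromℚᵘ-cong casted)
    where
    identity : ∀ a b → (a ℤ.* b) ℤ.* + 1 ≡ b ℤ.* (+ 1 ℤ.* a)
    identity = ℤ-Solver.solve-∀
    casted : mkℚᵘ (+ suc q) 0 ℚᵘ.* mkℚᵘ (+ p) q ℚᵘ.≃ mkℚᵘ (+ p) 0
    casted = *≡* (identity (+ suc q) (+ p))

  ℕtoℚ-*-recipℕ : ∀ d → ℕtoℚ (suc d) * recipℕ (suc d) ≡ 1ℚ
  ℕtoℚ-*-recipℕ d = ℕtoℚ-*-/ 1 (suc d)

  ℕtoℚ-cancelˡ : ∀ m .{{_ : NonZero m}} {p q} → ℕtoℚ m * p ≡ ℕtoℚ m * q → p ≡ q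
  ℕtoℚ-cancelˡ m {p} {q} eq = trans (sym (undo p)) (trans (cong (+ 1 / m *_) eq) (undo q))
    where
    undo : ∀ r → + 1 / m * (ℕtoℚ m * r) ≡ r
    undo r = begin
      + 1 / m * (ℕtoℚ m * r)   ≡⟨ sym (*-assoc (+ 1 / m) (ℕtoℚ m) r) ⟩
      + 1 / m * ℕtoℚ m * r     ≡⟨ cong (_* r) (trans (*-comm (+ 1 / m) (ℕtoℚ m)) (ℕtoℚ-*-/ 1 m)) ⟩
      1ℚ * r                   ≡⟨ *-identityˡ r ⟩
      r                        ∎

  ∑< : ℕ → (ℕ → ℚ) → ℚ
  ∑< zero    f = 0ℚ
  ∑< (suc n) f = f 0 + ∑< n (λ i → f (suc i))

  syntax ∑< n (λ i → e) = ∑[ i < n ] e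

  ∑<-cong : ∀ n {f g : ℕ → ℚ} → (∀ i → i < n → f i ≡ g i) → ∑< n f ≡ ∑< n g
  ∑<-cong zero    f≗g = refl
  ∑<-cong (suc n) f≗g = cong₂ _+_ (f≗g 0 (s≤s z≤n)) (∑<-cong n (λ i i<n → f≗g (suc i) (s≤s i<n)))

  ∑<-zero : ∀ n {f : ℕ → ℚ} → (∀ i → i < n → f i ≡ 0ℚ) → ∑< n f ≡ 0ℚ
  ∑<-zero zero    f≗0 = refl
  ∑<-zero (suc n) f≗0 = trans (cong₂ _+_ (f≗0 0 (s≤s z≤n)) (∑<-zero n (λ i i<n → f≗0 (suc i) (s≤s i<n))))
                              (+-identityˡ 0ℚ)

  ∑<-+ : ∀ n (f g : ℕ → ℚ) → ∑[ i < n ] (f i + g i) ≡ ∑< n f + ∑< n g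
  ∑<-+ zero    f g = sym (+-identityˡ 0ℚ)
  ∑<-+ (suc n) f g = trans (cong (_+_ (f 0 + g 0)) (∑<-+ n (λ i → f (suc i)) (λ i → g (suc i))))
    (solve 4 (λ a b c d → (a :+ b) :+ (c :+ d) := (a :+ c) :+ (b :+ d)) refl (f 0) (g 0) _ _)

  ∑<-*ˡ : ∀ n c (f : ℕ → ℚ) → ∑[ i < n ] (c * f i) ≡ c * ∑< n f
  ∑<-*ˡ zero    c f = sym (*-zeroʳ c)
  ∑<-*ˡ (suc n) c f = trans (cong (_+_ (c * f 0)) (∑<-*ˡ n c (λ i → f (suc i)))) (sym (*-distribˡ-+ c _ _))

  ∑<-split : ∀ m n (f : ℕ → ℚ) → ∑< (m ℕ.+ n) f ≡ ∑< m f + ∑[ i < n ] f (m ℕ.+ i)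
  ∑<-split zero    n f = sym (+-identityˡ _)
  ∑<-split (suc m) n f = trans (cong (_+_ (f 0)) (∑<-split m n (λ i → f (suc i)))) (sym (+-assoc (f 0) _ _))

  ∑<-last : ∀ n (f : ℕ → ℚ) → ∑< (suc n) f ≡ ∑< n f + f n
  ∑<-last n f = begin
    ∑< (suc n) f                 ≡⟨ cong (λ m → ∑< m f) (ℕₚ.+-comm 1 n) ⟩
    ∑< (n ℕ.+ 1) f               ≡⟨ ∑<-split n 1 f ⟩
    ∑< n f + (f (n ℕ.+ 0) + 0ℚ)  ≡⟨ cong (_+_ (∑< n f)) (trans (+-identityʳ _) (cong f (ℕₚ.+-identityʳ n))) ⟩
    ∑< n f + f n                 ∎

  ∑<-window : ∀ k w {n} (f : ℕ → ℚ) → k ℕ.+ w ≤ n →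
              (∀ i → i < k → f i ≡ 0ℚ) → (∀ i → k ℕ.+ w ≤ i → f i ≡ 0ℚ) →
              ∑< n f ≡ ∑[ i < w ] f (k ℕ.+ i)
  ∑<-window k w f k+w≤n below above with ℕₚ.m≤n⇒∃[o]m+o≡n k+w≤n
  ... | r , refl = begin
    ∑< (k ℕ.+ w ℕ.+ r) f
      ≡⟨ ∑<-split (k ℕ.+ w) r f ⟩
    ∑< (k ℕ.+ w) f + ∑[ i < r ] f (k ℕ.+ w ℕ.+ i)
      ≡⟨ cong₂ _+_ (∑<-split k w f) (∑<-zero r (λ i _ → above _ (ℕₚ.m≤m+n (k ℕ.+ w) i))) ⟩
    ∑< k f + ∑[ i < w ] f (k ℕ.+ i) + 0ℚ
      ≡⟨ +-identityʳ _ ⟩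
    ∑< k f + ∑[ i < w ] f (k ℕ.+ i)
      ≡⟨ cong (_+ ∑[ i < w ] f (k ℕ.+ i)) (∑<-zero k below) ⟩
    0ℚ + ∑[ i < w ] f (k ℕ.+ i)
      ≡⟨ +-identityˡ _ ⟩
    ∑[ i < w ] f (k ℕ.+ i) ∎

  ∑-toℕ : ∀ {b} {f : Fin b → ℚ} (g : ℕ → ℚ) → (∀ i → f i ≡ g (toℕ i)) → ∑ f ≡ ∑< b g
  ∑-toℕ {zero}  g f≗g = refl
  ∑-toℕ {suc b} g f≗g = cong₂ _+_ (f≗g Fin.zero) (∑-toℕ (λ i → g (suc i)) (λ i → f≗g (Fin.suc i)))

  m<n⇒stirling1≡0 : ∀ {m n} → m < n → stirling1 m n ≡ 0
  m<n⇒stirling1≡0 {zero}  {suc n} _           = refl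
  m<n⇒stirling1≡0 {suc m} {suc n} (s≤s m<n)
    rewrite m<n⇒stirling1≡0 (ℕₚ.m<n⇒m<1+n m<n) | m<n⇒stirling1≡0 m<n = trans (ℕₚ.+-identityʳ _) (ℕₚ.*-zeroʳ m)

  !-*-stirling1-suc : ∀ n d → n ! ℕ.* stirling1 (suc d) n
                              ≡ d ℕ.* (n ! ℕ.* stirling1 d n) ℕ.+ n ℕ.* (pred n ! ℕ.* stirling1 d (pred n))
  !-*-stirling1-suc zero    zero    = refl
  !-*-stirling1-suc zero    (suc d) = sym (trans (ℕₚ.+-identityʳ _) (ℕₚ.*-zeroʳ d))
  !-*-stirling1-suc (suc n) d       =
    identity n (n !) d (stirling1 d (suc n)) (stirling1 d n)
    where
    identity : ∀ n f d c₁ c₀ → (suc n ℕ.* f) ℕ.* (d ℕ.* c₁ ℕ.+ c₀)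
                                ≡ d ℕ.* ((suc n ℕ.* f) ℕ.* c₁) ℕ.+ suc n ℕ.* (f ℕ.* c₀)
    identity = ℕ-Solver.solve-∀

  scaledStirling : ℕ → ℕ → ℚ
  scaledStirling n d = factRatio n d * ℕtoℚ (stirling1 d n)

  ℕtoℚ-!-*-scaledStirling : ∀ n d → ℕtoℚ (d !) * scaledStirling n d ≡ ℕtoℚ (n ! ℕ.* stirling1 d n)
  ℕtoℚ-!-*-scaledStirling n d = begin
    ℕtoℚ (d !) * (factRatio n d * ℕtoℚ (stirling1 d n))
      ≡⟨ sym (*-assoc (ℕtoℚ (d !)) _ _) ⟩
    ℕtoℚ (d !) * factRatio n d * ℕtoℚ (stirling1 d n)
      ≡⟨ cong (_* ℕtoℚ (stirling1 d n)) (ℕtoℚ-*-/ (n !) (d !) {{d ℕₚ.!≢0}}) ⟩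
    ℕtoℚ (n !) * ℕtoℚ (stirling1 d n)
      ≡⟨ sym (ℕtoℚ-homo-* (n !) (stirling1 d n)) ⟩
    ℕtoℚ (n ! ℕ.* stirling1 d n) ∎

  scaledStirling-< : ∀ {n d} → d < n → scaledStirling n d ≡ 0ℚ
  scaledStirling-< {n} {d} d<n = trans (cong (λ c → factRatio n d * ℕtoℚ c) (m<n⇒stirling1≡0 d<n))
                                       (*-zeroʳ (factRatio n d))

  -- Multiplied by d !, this is the recurrence of the Stirling numbers.
  scaledStirling-rec : ∀ n d → ℕtoℚ (suc d) * scaledStirling n (suc d)
                               ≡ ℕtoℚ d * scaledStirling n d + ℕtoℚ n * scaledStirling (pred n) d
  scaledStirling-rec n d = ℕtoℚ-cancelˡ (d !) {{d ℕₚ.!≢0}} (begin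
    ℕtoℚ (d !) * (ℕtoℚ (suc d) * scaledStirling n (suc d))
      ≡⟨ solve 3 (λ f e s → f :* (e :* s) := e :* f :* s) refl (ℕtoℚ (d !)) (ℕtoℚ (suc d)) _ ⟩
    ℕtoℚ (suc d) * ℕtoℚ (d !) * scaledStirling n (suc d)
      ≡⟨ cong (_* scaledStirling n (suc d)) (sym (ℕtoℚ-homo-* (suc d) (d !))) ⟩
    ℕtoℚ (suc d !) * scaledStirling n (suc d)
      ≡⟨ ℕtoℚ-!-*-scaledStirling n (suc d) ⟩
    ℕtoℚ (n ! ℕ.* stirling1 (suc d) n)
      ≡⟨ cong ℕtoℚ (!-*-stirling1-suc n d) ⟩
    ℕtoℚ (d ℕ.* (n ! ℕ.* stirling1 d n) ℕ.+ n ℕ.* (pred n ! ℕ.* stirling1 d (pred n)))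
      ≡⟨ trans (ℕtoℚ-homo-+ (d ℕ.* _) (n ℕ.* _)) (cong₂ _+_ (ℕtoℚ-homo-* d _) (ℕtoℚ-homo-* n _)) ⟩
    ℕtoℚ d * ℕtoℚ (n ! ℕ.* stirling1 d n) + ℕtoℚ n * ℕtoℚ (pred n ! ℕ.* stirling1 d (pred n))
      ≡⟨ sym (cong₂ (λ a b → ℕtoℚ d * a + ℕtoℚ n * b)
                    (ℕtoℚ-!-*-scaledStirling n d) (ℕtoℚ-!-*-scaledStirling (pred n) d)) ⟩
    ℕtoℚ d * (ℕtoℚ (d !) * scaledStirling n d) + ℕtoℚ n * (ℕtoℚ (d !) * scaledStirling (pred n) d)
      ≡⟨ solve 5 (λ f e a m b → e :* (f :* a) :+ m :* (f :* b) := f :* (e :* a :+ m :* b))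
               refl (ℕtoℚ (d !)) (ℕtoℚ d) (scaledStirling n d) (ℕtoℚ n) (scaledStirling (pred n) d) ⟩
    ℕtoℚ (d !) * (ℕtoℚ d * scaledStirling n d + ℕtoℚ n * scaledStirling (pred n) d) ∎)

  recipConv : (ℕ → ℚ) → ℕ → ℚ
  recipConv f d = ∑[ m < d ] (recipℕ (d ∸ m) * f m)

  recipConv-*ˡ : ∀ c (f : ℕ → ℚ) d → recipConv (λ m → c * f m) d ≡ c * recipConv f d
  recipConv-*ˡ c f d = trans (∑<-cong d (λ m _ → solve 3 (λ r c y → r :* (c :* y) := c :* (r :* y))
                                                         refl (recipℕ (d ∸ m)) c (f m)))
                             (∑<-*ˡ d c (λ m → recipℕ (d ∸ m) * f m))

  ℕtoℚ-*-recipℕ-∸ : ∀ {m d} → m < d → ℕtoℚ d * recipℕ (d ∸ m) ≡ 1ℚ + ℕtoℚ m * recipℕ (d ∸ m)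
  ℕtoℚ-*-recipℕ-∸ {m} {suc d} (s≤s m≤d) rewrite ℕₚ.+-∸-assoc 1 m≤d = begin
    ℕtoℚ (suc d) * r                   ≡⟨ cong (λ n → ℕtoℚ n * r) (sym m+[1+e]≡1+d) ⟩
    ℕtoℚ (m ℕ.+ suc e) * r             ≡⟨ cong (_* r) (ℕtoℚ-homo-+ m (suc e)) ⟩
    (ℕtoℚ m + ℕtoℚ (suc e)) * r        ≡⟨ *-distribʳ-+ r (ℕtoℚ m) (ℕtoℚ (suc e)) ⟩
    ℕtoℚ m * r + ℕtoℚ (suc e) * r      ≡⟨ cong (_+_ (ℕtoℚ m * r)) (ℕtoℚ-*-recipℕ e) ⟩
    ℕtoℚ m * r + 1ℚ                    ≡⟨ +-comm (ℕtoℚ m * r) 1ℚ ⟩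
    1ℚ + ℕtoℚ m * r                    ∎
    where
    e : ℕ
    e = d ∸ m
    r : ℚ
    r = recipℕ (suc e)
    m+[1+e]≡1+d : m ℕ.+ suc e ≡ suc d
    m+[1+e]≡1+d = trans (ℕₚ.+-suc m e) (cong suc (ℕₚ.m+[n∸m]≡n m≤d))

  ℕtoℚ-*-recipConv : ∀ (f : ℕ → ℚ) d →
    ℕtoℚ d * recipConv f d ≡ ∑< d f + ∑[ m < d ] (recipℕ (d ∸ m) * (ℕtoℚ m * f m))
  ℕtoℚ-*-recipConv f d = begin
    ℕtoℚ d * recipConv f d
      ≡⟨ sym (∑<-*ˡ d (ℕtoℚ d) (λ m → recipℕ (d ∸ m) * f m)) ⟩
    ∑[ m < d ] (ℕtoℚ d * (recipℕ (d ∸ m) * f m))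
      ≡⟨ ∑<-cong d (λ m m<d → split m<d (f m)) ⟩
    ∑[ m < d ] (f m + recipℕ (d ∸ m) * (ℕtoℚ m * f m))
      ≡⟨ ∑<-+ d f (λ m → recipℕ (d ∸ m) * (ℕtoℚ m * f m)) ⟩
    ∑< d f + ∑[ m < d ] (recipℕ (d ∸ m) * (ℕtoℚ m * f m)) ∎
    where
    split : ∀ {m} → m < d → ∀ y → ℕtoℚ d * (recipℕ (d ∸ m) * y) ≡ y + recipℕ (d ∸ m) * (ℕtoℚ m * y)
    split {m} m<d y = begin
      ℕtoℚ d * (recipℕ (d ∸ m) * y)       ≡⟨ sym (*-assoc (ℕtoℚ d) (recipℕ (d ∸ m)) y) ⟩
      ℕtoℚ d * recipℕ (d ∸ m) * y         ≡⟨ cong (_* y) (ℕtoℚ-*-recipℕ-∸ m<d) ⟩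
      (1ℚ + ℕtoℚ m * recipℕ (d ∸ m)) * y  ≡⟨ solve 3 (λ a r y → (con 1ℚ :+ a :* r) :* y := y :+ r :* (a :* y))
                                                    refl (ℕtoℚ m) (recipℕ (d ∸ m)) y ⟩
      y + recipℕ (d ∸ m) * (ℕtoℚ m * y)   ∎

  recipConv-rec : ∀ (f g : ℕ → ℚ) → (∀ m → ℕtoℚ (suc m) * f (suc m) ≡ ℕtoℚ m * f m + g m) →
    ∀ d → ℕtoℚ (suc d) * recipConv f (suc d) ≡ ℕtoℚ d * recipConv f d + (f d + recipConv g d)
  recipConv-rec f g f-rec d = begin
    ℕtoℚ (suc d) * recipConv f (suc d)
      ≡⟨ ℕtoℚ-*-recipConv f (suc d) ⟩
    ∑< (suc d) f + (recipℕ (suc d) * (ℕtoℚ 0 * f 0)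
                    + ∑[ m < d ] (recipℕ (d ∸ m) * (ℕtoℚ (suc m) * f (suc m))))
      ≡⟨ cong₂ _+_ (∑<-last d f) (cong₂ _+_ head-vanishes (∑<-cong d (λ m _ → tail-rec m))) ⟩
    ∑< d f + f d + (0ℚ + ∑[ m < d ] (W m + recipℕ (d ∸ m) * g m))
      ≡⟨ cong (_+_ (∑< d f + f d)) (trans (+-identityˡ _) (∑<-+ d W (λ m → recipℕ (d ∸ m) * g m))) ⟩
    ∑< d f + f d + (∑< d W + recipConv g d)
      ≡⟨ solve 4 (λ a b c e → a :+ b :+ (c :+ e) := a :+ c :+ (b :+ e))
               refl (∑< d f) (f d) (∑< d W) (recipConv g d) ⟩
    ∑< d f + ∑< d W + (f d + recipConv g d)
      ≡⟨ cong (_+ (f d + recipConv g d)) (sym (ℕtoℚ-*-recipConv f d)) ⟩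
    ℕtoℚ d * recipConv f d + (f d + recipConv g d) ∎
    where
    W : ℕ → ℚ
    W m = recipℕ (d ∸ m) * (ℕtoℚ m * f m)
    head-vanishes : recipℕ (suc d) * (ℕtoℚ 0 * f 0) ≡ 0ℚ
    head-vanishes = trans (cong (recipℕ (suc d) *_) (*-zeroˡ (f 0))) (*-zeroʳ (recipℕ (suc d)))
    tail-rec : ∀ m → recipℕ (d ∸ m) * (ℕtoℚ (suc m) * f (suc m)) ≡ W m + recipℕ (d ∸ m) * g m
    tail-rec m = trans (cong (recipℕ (d ∸ m) *_) (f-rec m)) (*-distribˡ-+ (recipℕ (d ∸ m)) _ (g m))

  recurrence-unique : ∀ {u v h : ℕ → ℚ} → u 0 ≡ v 0 →
    (∀ d → ℕtoℚ (suc d) * u (suc d) ≡ ℕtoℚ d * u d + h d) →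
    (∀ d → ℕtoℚ (suc d) * v (suc d) ≡ ℕtoℚ d * v d + h d) →
    ∀ d → u d ≡ v d
  recurrence-unique u₀≡v₀ u-rec v-rec zero    = u₀≡v₀
  recurrence-unique {u} {v} {h} u₀≡v₀ u-rec v-rec (suc d) = ℕtoℚ-cancelˡ (suc d) (begin
    ℕtoℚ (suc d) * u (suc d)  ≡⟨ u-rec d ⟩
    ℕtoℚ d * u d + h d        ≡⟨ cong (λ w → ℕtoℚ d * w + h d) (recurrence-unique u₀≡v₀ u-rec v-rec d) ⟩
    ℕtoℚ d * v d + h d        ≡⟨ v-rec d ⟨
    ℕtoℚ (suc d) * v (suc d)  ∎)

  recipConv-scaledStirling-step : ∀ n →
    (∀ d → ℕtoℚ n * recipConv (scaledStirling (pred n)) d ≡ ℕtoℚ n * scaledStirling n d) →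
    ∀ d → recipConv (scaledStirling n) d ≡ scaledStirling (suc n) d
  recipConv-scaledStirling-step n previous =
    recurrence-unique (sym (scaledStirling-< {suc n} (s≤s z≤n))) conv-rec (scaledStirling-rec (suc n))
    where
    s : ℕ → ℚ
    s = scaledStirling n
    conv-rec : ∀ d → ℕtoℚ (suc d) * recipConv s (suc d) ≡ ℕtoℚ d * recipConv s d + ℕtoℚ (suc n) * s d
    conv-rec d = begin
      ℕtoℚ (suc d) * recipConv s (suc d)
        ≡⟨ recipConv-rec s (λ m → ℕtoℚ n * scaledStirling (pred n) m) (scaledStirling-rec n) d ⟩
      ℕtoℚ d * recipConv s d + (s d + recipConv (λ m → ℕtoℚ n * scaledStirling (pred n) m) d)
        ≡⟨ cong (λ z → ℕtoℚ d * recipConv s d + (s d + z))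
                (trans (recipConv-*ˡ (ℕtoℚ n) (scaledStirling (pred n)) d) (previous d)) ⟩
      ℕtoℚ d * recipConv s d + (s d + ℕtoℚ n * s d)
        ≡⟨ cong (_+_ (ℕtoℚ d * recipConv s d))
                (solve 2 (λ a y → y :+ a :* y := (con 1ℚ :+ a) :* y) refl (ℕtoℚ n) (s d)) ⟩
      ℕtoℚ d * recipConv s d + (1ℚ + ℕtoℚ n) * s d
        ≡⟨ cong (λ c → ℕtoℚ d * recipConv s d + c * s d) (sym (ℕtoℚ-homo-+ 1 n)) ⟩
      ℕtoℚ d * recipConv s d + ℕtoℚ (suc n) * s d ∎

  recipConv-scaledStirling : ∀ n d → recipConv (scaledStirling n) d ≡ scaledStirling (suc n) d
  recipConv-scaledStirling zero    = recipConv-scaledStirling-step zero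
    (λ d → trans (*-zeroˡ (recipConv (scaledStirling 0) d)) (sym (*-zeroˡ (scaledStirling 0 d))))
  recipConv-scaledStirling (suc n) = recipConv-scaledStirling-step (suc n)
    (λ d → cong (ℕtoℚ (suc n) *_) (recipConv-scaledStirling n d))

  toeplitz : (ℕ → ℚ) → ℕ → ℕ → ℚ
  toeplitz t j k with k ℕ.≤? j
  ... | yes _ = t (j ∸ k)
  ... | no  _ = 0ℚ

  toeplitz-≤ : ∀ {t j k} → k ≤ j → toeplitz t j k ≡ t (j ∸ k)
  toeplitz-≤ {j = j} {k} k≤j with k ℕ.≤? j
  ... | yes _   = refl
  ... | no  k≰j = contradiction k≤j k≰j

  toeplitz-≰ : ∀ {t j k} → ¬ k ≤ j → toeplitz t j k ≡ 0ℚ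
  toeplitz-≰ {j = j} {k} k≰j with k ℕ.≤? j
  ... | yes k≤j = contradiction k≤j k≰j
  ... | no  _   = refl

  toeplitz-cong : ∀ {s t : ℕ → ℚ} → (∀ d → s d ≡ t d) → ∀ j k → toeplitz s j k ≡ toeplitz t j k
  toeplitz-cong s≗t j k with k ℕ.≤? j
  ... | yes _ = s≗t (j ∸ k)
  ... | no  _ = refl

  _⋆_ : (ℕ → ℚ) → (ℕ → ℚ) → ℕ → ℚ
  (s ⋆ t) d = ∑[ m < suc d ] (s (d ∸ m) * t m)

  toeplitz-∑-* : ∀ (s t : ℕ → ℚ) {b j} k → j < b →
    ∑[ l < b ] (toeplitz s j l * toeplitz t l k) ≡ toeplitz (s ⋆ t) j k
  toeplitz-∑-* s t {b} {j} k j<b with k ℕ.≤? j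
  ... | no k≰j = ∑<-zero b (λ l _ → vanishes l)
    where
    vanishes : ∀ l → toeplitz s j l * toeplitz t l k ≡ 0ℚ
    vanishes l with k ℕ.≤? l
    ... | yes k≤l = trans (cong (_* t (l ∸ k)) (toeplitz-≰ (λ l≤j → k≰j (ℕₚ.≤-trans k≤l l≤j))))
                          (*-zeroˡ (t (l ∸ k)))
    ... | no  _   = *-zeroʳ (toeplitz s j l)
  ... | yes k≤j with ℕₚ.m≤n⇒∃[o]m+o≡n k≤j
  ...   | d , refl = begin
    ∑[ l < b ] (toeplitz s (k ℕ.+ d) l * toeplitz t l k)
      ≡⟨ ∑<-window k (suc d) _ (subst (_≤ b) (sym (ℕₚ.+-suc k d)) j<b) below above ⟩
    ∑[ i < suc d ] (toeplitz s (k ℕ.+ d) (k ℕ.+ i) * toeplitz t (k ℕ.+ i) k)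
      ≡⟨ ∑<-cong (suc d) (λ i i<1+d → inside (ℕₚ.≤-pred i<1+d)) ⟩
    (s ⋆ t) d
      ≡⟨ cong (s ⋆ t) (ℕₚ.m+n∸m≡n k d) ⟨
    (s ⋆ t) (k ℕ.+ d ∸ k) ∎
    where
    below : ∀ i → i < k → toeplitz s (k ℕ.+ d) i * toeplitz t i k ≡ 0ℚ
    below i i<k = trans (cong (toeplitz s (k ℕ.+ d) i *_) (toeplitz-≰ (ℕₚ.<⇒≱ i<k)))
                        (*-zeroʳ (toeplitz s (k ℕ.+ d) i))
    above : ∀ i → k ℕ.+ suc d ≤ i → toeplitz s (k ℕ.+ d) i * toeplitz t i k ≡ 0ℚ
    above i k+1+d≤i = trans (cong (_* toeplitz t i k) (toeplitz-≰ (ℕₚ.<⇒≱ k+d<i))) (*-zeroˡ (toeplitz t i k))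
      where
      k+d<i : k ℕ.+ d < i
      k+d<i = subst (_≤ i) (ℕₚ.+-suc k d) k+1+d≤i
    inside : ∀ {i} → i ≤ d → toeplitz s (k ℕ.+ d) (k ℕ.+ i) * toeplitz t (k ℕ.+ i) k ≡ s (d ∸ i) * t i
    inside {i} i≤d = cong₂ _*_
      (trans (toeplitz-≤ (ℕₚ.+-monoʳ-≤ k i≤d)) (cong s (ℕₚ.[m+n]∸[m+o]≡n∸o k d i)))
      (trans (toeplitz-≤ (ℕₚ.m≤m+n k i)) (cong t (ℕₚ.m+n∸m≡n k i)))

  X-toeplitz : ∀ {b} x (j k : Fin b) → X b x j k ≡ toeplitz (λ d → x * recipℕ d) (toℕ j) (toℕ k)
  X-toeplitz x j k with toℕ k ℕ.<? toℕ j
  ... | yes k<j = sym (toeplitz-≤ (ℕₚ.<⇒≤ k<j))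
  ... | no  k≮j with toℕ k ℕ.≤? toℕ j
  ...   | no  _   = refl
  ...   | yes k≤j rewrite ℕₚ.≤∧≮⇒≡ k≤j k≮j | ℕₚ.n∸n≡0 (toℕ j) = sym (*-zeroʳ x)

  idMat-toeplitz : ∀ {b} {t : ℕ → ℚ} → t 0 ≡ 1ℚ → (∀ d → t (suc d) ≡ 0ℚ) →
                   (j k : Fin b) → idMat j k ≡ toeplitz t (toℕ j) (toℕ k)
  idMat-toeplitz {t = t} t₀≡1 t₊≡0 j k with j Fin.≟ k
  ... | yes refl = sym (trans (toeplitz-≤ {t} {toℕ j} ℕₚ.≤-refl) (trans (cong t (ℕₚ.n∸n≡0 (toℕ j))) t₀≡1))
  ... | no  j≢k with toℕ k ℕ.≤? toℕ j
  ...   | no  _   = refl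
  ...   | yes k≤j with toℕ j ∸ toℕ k in j∸k≡d
  ...     | zero  = contradiction (toℕ-injective (ℕₚ.≤-antisym (ℕₚ.m∸n≡0⇒m≤n j∸k≡d) k≤j)) j≢k
  ...     | suc d = sym (t₊≡0 d)

  χ : ℚ → ℕ → ℕ → ℚ
  χ x n d = scaledStirling n d * x ^ℚ n

  recip⋆χ : ∀ x n d → ((λ e → x * recipℕ e) ⋆ χ x n) d ≡ χ x (suc n) d
  recip⋆χ x n d = begin
    ∑[ m < suc d ] (x * recipℕ (d ∸ m) * χ x n m)
      ≡⟨ ∑<-last d (λ m → x * recipℕ (d ∸ m) * χ x n m) ⟩
    ∑[ m < d ] (x * recipℕ (d ∸ m) * χ x n m) + x * recipℕ (d ∸ d) * χ x n d
      ≡⟨ cong₂ _+_ (∑<-cong d (λ m _ → regroup (recipℕ (d ∸ m)) (scaledStirling n m))) diagonal-vanishes ⟩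
    ∑[ m < d ] (x * x ^ℚ n * (recipℕ (d ∸ m) * scaledStirling n m)) + 0ℚ
      ≡⟨ +-identityʳ _ ⟩
    ∑[ m < d ] (x * x ^ℚ n * (recipℕ (d ∸ m) * scaledStirling n m))
      ≡⟨ ∑<-*ˡ d (x * x ^ℚ n) (λ m → recipℕ (d ∸ m) * scaledStirling n m) ⟩
    x * x ^ℚ n * recipConv (scaledStirling n) d
      ≡⟨ cong (x * x ^ℚ n *_) (recipConv-scaledStirling n d) ⟩
    x * x ^ℚ n * scaledStirling (suc n) d
      ≡⟨ *-comm (x * x ^ℚ n) (scaledStirling (suc n) d) ⟩
    χ x (suc n) d ∎
    where
    regroup : ∀ r a → x * r * (a * x ^ℚ n) ≡ x * x ^ℚ n * (r * a)
    regroup r a = solve 4 (λ x r a y → x :* r :* (a :* y) := x :* y :* (r :* a)) refl x r a (x ^ℚ n)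
    diagonal-vanishes : x * recipℕ (d ∸ d) * χ x n d ≡ 0ℚ
    diagonal-vanishes rewrite ℕₚ.n∸n≡0 d = trans (cong (_* χ x n d) (*-zeroʳ x)) (*-zeroˡ (χ x n d))

  matPow-X : ∀ b x n (j k : Fin b) → matPow (X b x) n j k ≡ toeplitz (χ x n) (toℕ j) (toℕ k)
  matPow-X b x zero    = idMat-toeplitz refl (λ d → cong (_* 1ℚ) (*-zeroʳ (factRatio 0 (suc d))))
  matPow-X b x (suc n) j k = begin
    ∑ (λ l → X b x j l * matPow (X b x) n l k)
      ≡⟨ ∑-toℕ _ (λ l → cong₂ _*_ (X-toeplitz x j l) (matPow-X b x n l k)) ⟩
    ∑[ l < b ] (toeplitz xℓ (toℕ j) l * toeplitz (χ x n) l (toℕ k))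
      ≡⟨ toeplitz-∑-* xℓ (χ x n) (toℕ k) (toℕ<n j) ⟩
    toeplitz (xℓ ⋆ χ x n) (toℕ j) (toℕ k)
      ≡⟨ toeplitz-cong (recip⋆χ x n) (toℕ j) (toℕ k) ⟩
    toeplitz (χ x (suc n)) (toℕ j) (toℕ k) ∎
    where
    xℓ : ℕ → ℚ
    xℓ e = x * recipℕ e

  toeplitz-χ-≰ : ∀ x n {j k} → ¬ k ℕ.+ n ≤ j → toeplitz (χ x n) j k ≡ 0ℚ
  toeplitz-χ-≰ x n {j} {k} k+n≰j with k ℕ.≤? j
  ... | no  _   = refl
  ... | yes k≤j = trans (cong (_* x ^ℚ n) (scaledStirling-< j∸k<n)) (*-zeroˡ (x ^ℚ n))
    where
    j∸k<n : j ∸ k < n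
    j∸k<n = ℕₚ.≰⇒> (λ n≤j∸k → k+n≰j (subst (k ℕ.+ n ≤_) (ℕₚ.m+[n∸m]≡n k≤j) (ℕₚ.+-monoʳ-≤ k n≤j∸k)))

  toeplitz-χ-≤ : ∀ x n {j k} → k ℕ.+ n ≤ j → toeplitz (χ x n) j k ≡ χ x n (j ∸ k)
  toeplitz-χ-≤ x n {k = k} k+n≤j = toeplitz-≤ (ℕₚ.m+n≤o⇒m≤o k k+n≤j)

open import Data.Nat using (ℕ; _+_; _∸_; _≤_)
open import Data.Fin using (Fin; toℕ)
open import Data.Rational using (ℚ; _*_; 0ℚ)
open import Data.Product using (_×_; _,_)
open import Relation.Nullary using (¬_)
open import Relation.Binary.PropositionalEquality using (_≡_; trans)

lemma2p7 : (b : ℕ) → 2 ≤ b → (n : ℕ) → 1 ≤ n → n ≤ b ∸ 1 →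
             (x : ℚ) (j k : Fin b) →
             (toℕ k + n ≤ toℕ j →
                matPow (X b x) n j k
                  ≡ factRatio n (toℕ j ∸ toℕ k) * ℕtoℚ (stirling1 (toℕ j ∸ toℕ k) n) * (x ^ℚ n))
             × (¬ (toℕ k + n ≤ toℕ j) → matPow (X b x) n j k ≡ 0ℚ)
lemma2p7 b _ n _ _ x j k =
    (λ k+n≤j → trans (matPow-X b x n j k) (toeplitz-χ-≤ x n k+n≤j))
  , (λ k+n≰j → trans (matPow-X b x n j k) (toeplitz-χ-≰ x n k+n≰j))
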